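{- Let $(S,B)$ be a restriction monoid with tests, carrying an extended if-then-else operation satisfying $D(s\alpha)(s,\alpha)[t,u]=D(s\alpha)t$, $D(s\alpha')(s,\alpha)[t,u]=D(s\alpha')u$, $D((s,\alpha)[t,u])\le D(s)$, and an extended while-do operation $((t,\alpha):s)$ satisfying the Kleenean W-monoid axioms. Suppose the semigroup $S$ is periodic. Then any representation $\theta$ of $(S,B)$ as a functional restriction monoid with tests correctly represents both extended if-then-else and extended while-do, i.e. $\theta((s,\alpha)[t,u])=(\theta(s),\theta(\alpha))[\theta(t),\theta(u)]$ and $\theta(((t,\alpha):s))=((\theta(t),\theta(\alpha)):\theta(s))$ for all $s,t,u\in S$, $\alpha\in B$, where the right-hand sides are the concrete operations on partial functions.
   Context: A monoid with tests is a pair $(S,B)$ with $S$ a monoid with identity $1$ and zero $0$, and $B\subseteq S$ a commutative submonoid of idempotents containing $0$ with unary $'$ making $(B,\cdot,{}',0,1)$ a Boolean algebra with meet the multiplication. A restriction monoid with tests additionally has unary $D$ with, for all $s,t,u\in S$, $\alpha,\beta\in B$: $D(s)s=s$; $D(st)=D(s)D(st)$; $D(s)D(t)=D(t)D(s)$; $D(D(s))=D(s)$; $sD(t)=D(st)s$; $D(\alpha)=\alpha$; $D(s\beta)t=D(s\beta)u$ and $D(s\beta')t=D(s\beta')u$ imply $D(s)t=D(s)u$. Natural order: $s\le t$ iff $s=D(s)t$. The Kleenean W-monoid axioms are: $((t,\alpha):s)=(t,\alpha)[s((t,\alpha):s),1]$; $((t,\alpha):s)D(t\alpha')=((t,\alpha):s)$;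 and $D(t\alpha)su\le u$ implies $((t,\alpha):s)u\le u$. A semigroup is periodic if for each $x$ there are positive integers $i,p$ with $x^i=x^{i+p}$. A representation as a functional restriction monoid with tests is an injective map $\theta:S\to\mathcal P(X)$ into the partial functions on a set $X$ (composed left to right, $(fg)(x)=g(f(x))$) preserving multiplication, identity and $D$ (where $D(f)$ is the identity on $\mathrm{dom} f$), mapping $B$ into restrictions of the identity with $\theta(\alpha')$ the identity on $X\setminus\mathrm{dom}\,\theta(\alpha)$. Concrete operations on partial functions, with a test $\alpha$ identified with its domain: $(f,\alpha)[g,h](x)=g(x)$ if $f(x)$ is defined and in $\alpha$, $h(x)$ if $f(x)$ is defined and not in $\alpha$, undefined otherwise; $((f,\alpha):g)(x)=g^n(x)$ if for all $0\le m<n$, $g^m(x)$ and $f(g^m(x))$ are defined with $f(g^m(x))\in\alpha$, while $g^n(x)$ and $f(g^n(x))$ are defined with $f(g^n(x))\notin\alpha$ (with $g^0(x)=x$); undefined otherwise. -}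

module Defs where

open import Level using (Level; _⊔_) renaming (suc to lsuc)
open import Data.Nat using (ℕ; zero; suc; _+_; _<_)
open import Data.Maybe using (Maybe; just; nothing; _>>=_)
open import Data.Product using (Σ; ∃; _×_; _,_)
open import Data.Sum using (_⊎_)
open import Relation.Binary.PropositionalEquality using (_≡_)
import Algebra.Structures as AS
import Algebra.Lattice.Structures as LS

-- The operations on B are inherited: ι preserves 0, 1 and
-- multiplication, and (B, ∧, ′, 0, 1) is a Boolean algebra whose meet
-- is the (restricted) multiplication; the join is the de Morgan dual.

record RestrictionMonoidWithTests {a b : Level} (S : Set a) (B : Set b)
       : Set (a ⊔ b) where
  infixl 7 _·_
  field
    _·_ : S → S → S
    𝟙 𝟘 : S
    isMonoid : AS.IsMonoid _≡_ _·_ 𝟙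
    zeroˡ : ∀ s → 𝟘 · s ≡ 𝟘
    zeroʳ : ∀ s → s · 𝟘 ≡ 𝟘
    ι : B → S
    ι-injective : ∀ {α β} → ι α ≡ ι β → α ≡ β
    _∧_ : B → B → B
    _′ : B → B
    0B 1B : B
    ι-0 : ι 0B ≡ 𝟘
    ι-1 : ι 1B ≡ 𝟙
    ι-· : ∀ α β → ι (α ∧ β) ≡ ι α · ι β
    isBooleanAlgebra :
      LS.IsBooleanAlgebra _≡_ (λ α β → ((α ′) ∧ (β ′)) ′) _∧_ _′ 1B 0B
    D : S → S
    D-left   : ∀ s → D s · s ≡ s
    D-prod   : ∀ s t → D (s · t) ≡ D s · D (s · t)
    D-comm   : ∀ s t → D s · D t ≡ D t · D s
    D-idem   : ∀ s → D (D s) ≡ D s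
    D-twist  : ∀ s t → s · D t ≡ D (s · t) · s
    D-test   : ∀ α → D (ι α) ≡ ι α
    D-split  : ∀ s β t u →
               D (s · ι β) · t ≡ D (s · ι β) · u →
               D (s · ι (β ′)) · t ≡ D (s · ι (β ′)) · u →
               D s · t ≡ D s · u

  _≤_ : S → S → Set a
  s ≤ t = s ≡ D s · t

-- Extended if-then-else:  ite s α t u  stands for  (s , α)[ t , u ].

record ExtendedIfThenElse {a b} {S : Set a} {B : Set b}
       (R : RestrictionMonoidWithTests S B) : Set (a ⊔ b) where
  open RestrictionMonoidWithTests R
  field
    ite : S → B → S → S → S
    ite-yes : ∀ s α t u → D (s · ι α) · ite s α t u ≡ D (s · ι α) · t
    ite-no  : ∀ s α t u → D (s · ι (α ′)) · ite s α t u ≡ D (s · ι (α ′)) · u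
    ite-dom : ∀ s α t u → D (ite s α t u) ≤ D s

-- Extended while-do satisfying the Kleenean W-monoid axioms:
--  while t α s  stands for  ((t , α) : s).

record KleeneanWhile {a b} {S : Set a} {B : Set b}
       (R : RestrictionMonoidWithTests S B) (I : ExtendedIfThenElse R)
       : Set (a ⊔ b) where
  open RestrictionMonoidWithTests R
  open ExtendedIfThenElse I
  field
    while : S → B → S → S
    while-unfold : ∀ t α s → while t α s ≡ ite t α (s · while t α s) 𝟙
    while-exit   : ∀ t α s → while t α s · D (t · ι (α ′)) ≡ while t α s
    while-induct : ∀ t α s u →
                   (D (t · ι α) · s · u) ≤ u → (while t α s · u) ≤ u

pow : ∀ {a} {S : Set a} → (S → S → S) → S → ℕ → S
pow _·_ x zero    = x                        -- pow x k = x^(k+1)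
pow _·_ x (suc k) = _·_ (pow _·_ x k) x

-- x^i = x^(i+p) for some positive i, p  (x^(i) written pow x (i-1))
Periodic : ∀ {a} {S : Set a} → (S → S → S) → Set a
Periodic {S = S} _·_ =
  ∀ (x : S) → Σ ℕ λ i → Σ ℕ λ p → pow _·_ x i ≡ pow _·_ x (i + suc p)

-- Partial functions on X, composed left to right.

PFun : ∀ {x} → Set x → Set x
PFun X = X → Maybe X

_⨾_ : ∀ {x} {X : Set x} → PFun X → PFun X → PFun X
(f ⨾ g) x = f x >>= g

domId : ∀ {x} {X : Set x} → PFun X → PFun X
domId f x with f x
... | just _  = just x
... | nothing = nothing

codomId : ∀ {x} {X : Set x} → PFun X → PFun X
codomId f x with f x
... | just _  = nothing
... | nothing = just x

-- concrete if-then-else  (f , α)[ g , h ]  (α a partial identity)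
concreteIte : ∀ {x} {X : Set x} → PFun X → PFun X → PFun X → PFun X → PFun X
concreteIte f α g h x with f x
... | nothing = nothing
... | just y with α y
...   | just _  = g x
...   | nothing = h x

iter : ∀ {x} {X : Set x} → PFun X → ℕ → PFun X
iter g zero    x = just x
iter g (suc n) x = iter g n x >>= g

InTest : ∀ {x} {X : Set x} → PFun X → PFun X → X → Set x
InTest f α z = Σ _ λ w → f z ≡ just w × Σ _ λ w' → α w ≡ just w'

OutTest : ∀ {x} {X : Set x} → PFun X → PFun X → X → Set x
OutTest f α z = Σ _ λ w → f z ≡ just w × α w ≡ nothing

-- concrete while-do: ((f , α) : g)(x) = y, given as the graph of the
-- partial function.
ConcreteWhile : ∀ {x} {X : Set x} → PFun X → PFun X → PFun X → X → X → Set x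
ConcreteWhile f α g x y =
  Σ ℕ λ n →
    (∀ m → m < n → Σ _ λ z → iter g m x ≡ just z × InTest f α z)
    × iter g n x ≡ just y × OutTest f α y

record Representation {a b} {S : Set a} {B : Set b}
       (R : RestrictionMonoidWithTests S B) {x} (X : Set x)
       : Set (a ⊔ b ⊔ x) where
  open RestrictionMonoidWithTests R
  field
    θ : S → PFun X
    θ-injective : ∀ s t → (∀ z → θ s z ≡ θ t z) → s ≡ t
    θ-· : ∀ s t z → θ (s · t) z ≡ (θ s ⨾ θ t) z
    θ-1 : ∀ z → θ 𝟙 z ≡ just z
    θ-D : ∀ s z → θ (D s) z ≡ domId (θ s) z
    θ-test : ∀ α z → θ (ι α) z ≡ just z ⊎ θ (ι α) z ≡ nothing
    θ-′ : ∀ α z → θ (ι (α ′)) z ≡ codomId (θ (ι α)) z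

-- If-then-else is forced pointwise: D(sα) and D(sα′) restrict to the points where the
-- concrete test succeeds or fails, and the domain axiom makes the operation undefined
-- where s is.  For while-do, unroll the loop: u₀ = D(tα′), u_{k+1} = (t,α)[s u_k , 1], so
-- that θ(u_k) is the concrete loop cut off after k iterations.  Periodicity of the guarded
-- body x = D(tα)s, x^{i+1} = x^{i+p+2}, rules out runs of exactly i+1 iterations: x^{i+1}
-- would reach an exit point, where x is undefined.  Hence x u_i ≤ u_i, and the induction
-- axiom gives ((t,α):s) u_i ≤ u_i.  Every output of the loop is an exit point, fixed by
-- u_i, so θ((t,α):s) ⊆ θ(u_i) ⊆ concrete loop; the converse inclusion is by unfolding.
module Submission where

open import Defs
open import Level using (Level)
open import Data.Maybe using (Maybe; just; nothing; _>>=_)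
open import Data.Maybe.Properties using (just-injective)
open import Data.Product using (_×_; _,_; Σ; proj₂; map₂)
open import Data.Sum using (_⊎_; inj₁; inj₂)
open import Data.Nat using (ℕ; zero; suc; _+_; _<_; z≤n; s≤s; s≤s⁻¹)
import Data.Nat as ℕ
open import Data.Nat.Properties using (≤∧≢⇒<)
open import Function.Bundles using (_⇔_; mk⇔)
open import Relation.Nullary using (¬_)
open import Relation.Binary.PropositionalEquality

module PartialFunctions {ℓ} {X : Set ℓ} where

  Defined : PFun X → X → Set ℓ
  Defined f a = Σ X λ w → f a ≡ just w

  >>=-just-inv : ∀ (m : Maybe X) (g : PFun X) {c} → (m >>= g) ≡ just c →
                 Σ X λ w → m ≡ just w × g w ≡ just c
  >>=-just-inv (just w) g e = w , refl , e

  iter-sucˡ : ∀ (g : PFun X) n a → iter g (suc n) a ≡ (g a >>= iter g n)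
  iter-sucˡ g zero a with g a
  ... | just _  = refl
  ... | nothing = refl
  iter-sucˡ g (suc n) a rewrite iter-sucˡ g n a with g a
  ... | just _  = refl
  ... | nothing = refl

  iter-shift : ∀ (g : PFun X) n {a a'} → g a ≡ just a' → iter g (suc n) a ≡ iter g n a'
  iter-shift g n {a} e = trans (iter-sucˡ g n a) (cong (_>>= iter g n) e)

  test-cases : ∀ (f α : PFun X) a → f a ≡ nothing ⊎ InTest f α a ⊎ OutTest f α a
  test-cases f α a with f a
  ... | nothing = inj₁ refl
  ... | just w with α w in eα
  ...   | just w' = inj₂ (inj₁ (w , refl , w' , eα))
  ...   | nothing = inj₂ (inj₂ (w , refl , eα))

  module _ (f α g h : PFun X) {a : X} where

    concreteIte-undefined : f a ≡ nothing → concreteIte f α g h a ≡ nothing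
    concreteIte-undefined ef with f a | ef
    ... | nothing | _ = refl

    concreteIte-in : InTest f α a → concreteIte f α g h a ≡ g a
    concreteIte-in (w , ef , _ , eα) with f a | ef
    ... | just .w | refl with α w | eα
    ...   | just _ | _ = refl

    concreteIte-out : OutTest f α a → concreteIte f α g h a ≡ h a
    concreteIte-out (w , ef , eα) with f a | ef
    ... | just .w | refl with α w | eα
    ...   | nothing | _ = refl

    concreteIte-just-inv : ∀ {c} → concreteIte f α g h a ≡ just c →
                           InTest f α a × g a ≡ just c ⊎ OutTest f α a × h a ≡ just c
    concreteIte-just-inv e with test-cases f α a
    ... | inj₁ ef with trans (sym (concreteIte-undefined ef)) e
    ...   | ()
    concreteIte-just-inv e | inj₂ (inj₁ i) = inj₁ (i , trans (sym (concreteIte-in i)) e)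
    concreteIte-just-inv e | inj₂ (inj₂ o) = inj₂ (o , trans (sym (concreteIte-out o)) e)

  module ConcreteLoop (f α g : PFun X) where

    -- ConcreteWhile f α g a c unfolds to Σ ℕ λ n → ExitsAfter n a c.
    ExitsAfter : ℕ → X → X → Set ℓ
    ExitsAfter n a c =
      (∀ m → m < n → Σ X λ z → iter g m a ≡ just z × InTest f α z)
      × iter g n a ≡ just c × OutTest f α c

    exitsAfter-zero : ∀ {a} → OutTest f α a → ExitsAfter 0 a a
    exitsAfter-zero o = (λ _ ()) , refl , o

    exitsAfter-zero-inv : ∀ {a c} → ExitsAfter 0 a c → a ≡ c
    exitsAfter-zero-inv (_ , e , _) = just-injective e

    exitsAfter-suc : ∀ {n a a' c} → InTest f α a → g a ≡ just a' →
                     ExitsAfter n a' c → ExitsAfter (suc n) a c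
    exitsAfter-suc {n} {a} i eg (inside , reach , out) =
      inside' , trans (iter-shift g n eg) reach , out
      where
      inside' : ∀ m → m < suc n → Σ X λ z → iter g m a ≡ just z × InTest f α z
      inside' zero _ = a , refl , i
      inside' (suc m) (s≤s m<n) with inside m m<n
      ... | z , ez , iz = z , trans (iter-shift g m eg) ez , iz

    exitsAfter-suc-inv : ∀ {n a c} → ExitsAfter (suc n) a c →
                         InTest f α a × Σ X λ a' → g a ≡ just a' × ExitsAfter n a' c
    exitsAfter-suc-inv {n} {a} (inside , reach , out)
      with inside 0 (s≤s z≤n) | >>=-just-inv (g a) (iter g n) (trans (sym (iter-sucˡ g n a)) reach)
    ... | .a , refl , i | a' , eg , reach' = i , a' , eg , inside' , reach' , out
      where
      inside' : ∀ m → m < n → Σ X λ z → iter g m a' ≡ just z × InTest f α z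
      inside' m m<n with inside (suc m) (s≤s m<n)
      ... | z , ez , iz = z , trans (sym (iter-shift g m eg)) ez , iz

open PartialFunctions

module RepresentationProperties {a b ℓ : Level} {S : Set a} {B : Set b}
    (R : RestrictionMonoidWithTests S B) {X : Set ℓ} (ρ : Representation R X) where
  open RestrictionMonoidWithTests R
  open Representation ρ

  θ-·-just : ∀ p q {z w} → θ p z ≡ just w → θ (p · q) z ≡ θ q w
  θ-·-just p q {z} e = trans (θ-· p q z) (cong (_>>= θ q) e)

  θ-·-nothing : ∀ p q {z} → θ p z ≡ nothing → θ (p · q) z ≡ nothing
  θ-·-nothing p q {z} e = trans (θ-· p q z) (cong (_>>= θ q) e)

  θ-·-just-inv : ∀ p q {z c} → θ (p · q) z ≡ just c → Σ X λ w → θ p z ≡ just w × θ q w ≡ just c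
  θ-·-just-inv p q {z} e = >>=-just-inv (θ p z) (θ q) (trans (sym (θ-· p q z)) e)

  θ-pow : ∀ p k z → θ (pow _·_ p k) z ≡ iter (θ p) (suc k) z
  θ-pow p zero z = refl
  θ-pow p (suc k) z = trans (θ-· (pow _·_ p k) p z) (cong (_>>= θ p) (θ-pow p k z))

  θ-D-defined : ∀ p {z} → Defined (θ p) z → θ (D p) z ≡ just z
  θ-D-defined p {z} (w , e) with θ p z | θ-D p z
  θ-D-defined p (w , refl) | just .w | eD = eD

  θ-D-undefined : ∀ p {z} → θ p z ≡ nothing → θ (D p) z ≡ nothing
  θ-D-undefined p {z} e with θ p z | θ-D p z
  θ-D-undefined p refl | nothing | eD = eD

  θ-D-just-inv : ∀ p {z c} → θ (D p) z ≡ just c → c ≡ z × Defined (θ p) z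
  θ-D-just-inv p {z} e with θ p z | θ-D p z
  ... | just w  | eD = just-injective (trans (sym e) eD) , w , refl
  ... | nothing | eD with trans (sym e) eD
  ...   | ()

  θ-restrict : ∀ p q {z} → Defined (θ p) z → θ (D p · q) z ≡ θ q z
  θ-restrict p q d = θ-·-just (D p) q (θ-D-defined p d)

  θ-restrict-undefined : ∀ p q {z} → θ p z ≡ nothing → θ (D p · q) z ≡ nothing
  θ-restrict-undefined p q e = θ-·-nothing (D p) q (θ-D-undefined p e)

  θ-restrict-just-inv : ∀ p q {z c} → θ (D p · q) z ≡ just c → Defined (θ p) z × θ q z ≡ just c
  θ-restrict-just-inv p q e with θ-·-just-inv (D p) q e
  ... | w , eD , eq with θ-D-just-inv p eD
  ...   | refl , d = d , eq

  ≤⇒θ-⊆ : ∀ {p q z c} → p ≤ q → θ p z ≡ just c → θ q z ≡ just c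
  ≤⇒θ-⊆ {p} {q} p≤q e =
    trans (sym (θ-restrict p q (_ , e))) (trans (cong (λ r → θ r _) (sym p≤q)) e)

  θ-⊆⇒≤ : ∀ {p q} → (∀ z c → θ p z ≡ just c → θ q z ≡ just c) → p ≤ q
  θ-⊆⇒≤ {p} {q} p⊆q = θ-injective p (D p · q) agree
    where
    agree : ∀ z → θ p z ≡ θ (D p · q) z
    agree z with θ p z in e
    ... | nothing = sym (θ-restrict-undefined p q e)
    ... | just c  = sym (trans (θ-restrict p q (c , e)) (p⊆q z c e))

  complement-just : ∀ α {w} → θ (ι α) w ≡ nothing → θ (ι (α ′)) w ≡ just w
  complement-just α {w} e with θ (ι α) w | θ-′ α w
  complement-just α refl | nothing | e′ = e′

  complement-just-inv : ∀ α {w c} → θ (ι (α ′)) w ≡ just c → θ (ι α) w ≡ nothing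
  complement-just-inv α {w} e with θ (ι α) w | θ-′ α w
  ... | nothing | _  = refl
  ... | just _  | e′ with trans (sym e) e′
  ...   | ()

  inTest⇒defined : ∀ t α {z} → InTest (θ t) (θ (ι α)) z → Defined (θ (t · ι α)) z
  inTest⇒defined t α (w , et , w' , eα) = w' , trans (θ-·-just t (ι α) et) eα

  defined⇒inTest : ∀ t α {z} → Defined (θ (t · ι α)) z → InTest (θ t) (θ (ι α)) z
  defined⇒inTest t α (_ , e) with θ-·-just-inv t (ι α) e
  ... | w , et , eα = w , et , _ , eα

  outTest⇒defined : ∀ t α {z} → OutTest (θ t) (θ (ι α)) z → Defined (θ (t · ι (α ′))) z
  outTest⇒defined t α (w , et , eα) = w , trans (θ-·-just t (ι (α ′)) et) (complement-just α eα)

  defined⇒outTest : ∀ t α {z} → Defined (θ (t · ι (α ′))) z → OutTest (θ t) (θ (ι α)) z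
  defined⇒outTest t α (_ , e) with θ-·-just-inv t (ι (α ′)) e
  ... | w , et , e′ = w , et , complement-just-inv α e′

  outTest⇒undefined : ∀ t α {z} → OutTest (θ t) (θ (ι α)) z → θ (t · ι α) z ≡ nothing
  outTest⇒undefined t α (w , et , eα) = trans (θ-·-just t (ι α) et) eα

module IfThenElse {a b ℓ : Level} {S : Set a} {B : Set b}
    (R : RestrictionMonoidWithTests S B) (I : ExtendedIfThenElse R)
    {X : Set ℓ} (ρ : Representation R X) where
  open RestrictionMonoidWithTests R
  open ExtendedIfThenElse I
  open Representation ρ
  open RepresentationProperties R ρ

  θ-ite-undefined : ∀ s α t u {z} → θ s z ≡ nothing → θ (ite s α t u) z ≡ nothing
  θ-ite-undefined s α t u {z} es with θ (ite s α t u) z in e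
  ... | nothing = refl
  ... | just c with θ-D-just-inv s (≤⇒θ-⊆ (ite-dom s α t u) (θ-D-defined (ite s α t u) (c , e)))
  ...   | _ , _ , es' with trans (sym es) es'
  ...     | ()

  θ-ite-in : ∀ s α t u {z} → InTest (θ s) (θ (ι α)) z → θ (ite s α t u) z ≡ θ t z
  θ-ite-in s α t u {z} i = begin
    θ (ite s α t u) z                ≡⟨ sym (θ-restrict (s · ι α) (ite s α t u) d) ⟩
    θ (D (s · ι α) · ite s α t u) z  ≡⟨ cong (λ r → θ r z) (ite-yes s α t u) ⟩
    θ (D (s · ι α) · t) z            ≡⟨ θ-restrict (s · ι α) t d ⟩
    θ t z                            ∎
    where
    open ≡-Reasoning
    d : Defined (θ (s · ι α)) z
    d = inTest⇒defined s α i

  θ-ite-out : ∀ s α t u {z} → OutTest (θ s) (θ (ι α)) z → θ (ite s α t u) z ≡ θ u z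
  θ-ite-out s α t u {z} o = begin
    θ (ite s α t u) z                    ≡⟨ sym (θ-restrict (s · ι (α ′)) (ite s α t u) d) ⟩
    θ (D (s · ι (α ′)) · ite s α t u) z  ≡⟨ cong (λ r → θ r z) (ite-no s α t u) ⟩
    θ (D (s · ι (α ′)) · u) z            ≡⟨ θ-restrict (s · ι (α ′)) u d ⟩
    θ u z                                ∎
    where
    open ≡-Reasoning
    d : Defined (θ (s · ι (α ′))) z
    d = outTest⇒defined s α o

  θ-ite : ∀ s α t u z → θ (ite s α t u) z ≡ concreteIte (θ s) (θ (ι α)) (θ t) (θ u) z
  θ-ite s α t u z with test-cases (θ s) (θ (ι α)) z
  ... | inj₁ es =
    trans (θ-ite-undefined s α t u es) (sym (concreteIte-undefined (θ s) (θ (ι α)) (θ t) (θ u) es))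
  ... | inj₂ (inj₁ i) =
    trans (θ-ite-in s α t u i) (sym (concreteIte-in (θ s) (θ (ι α)) (θ t) (θ u) i))
  ... | inj₂ (inj₂ o) =
    trans (θ-ite-out s α t u o) (sym (concreteIte-out (θ s) (θ (ι α)) (θ t) (θ u) o))

  θ-ite-just-inv : ∀ s α t u {z c} → θ (ite s α t u) z ≡ just c →
                   InTest (θ s) (θ (ι α)) z × θ t z ≡ just c
                   ⊎ OutTest (θ s) (θ (ι α)) z × θ u z ≡ just c
  θ-ite-just-inv s α t u {z} e =
    concreteIte-just-inv (θ s) (θ (ι α)) (θ t) (θ u) (trans (sym (θ-ite s α t u z)) e)

module WhileDo {a b ℓ : Level} {S : Set a} {B : Set b}
    (R : RestrictionMonoidWithTests S B) (I : ExtendedIfThenElse R) (W : KleeneanWhile R I)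
    {X : Set ℓ} (ρ : Representation R X) where
  open RestrictionMonoidWithTests R
  open ExtendedIfThenElse I
  open KleeneanWhile W
  open Representation ρ
  open RepresentationProperties R ρ
  open IfThenElse R I ρ

  module _ (t : S) (α : B) (s : S) where
    open ConcreteLoop (θ t) (θ (ι α)) (θ s)

    body : S
    body = D (t · ι α) · s

    approx : ℕ → S
    approx zero    = D (t · ι (α ′))
    approx (suc k) = ite t α (s · approx k) 𝟙

    θ-body-just : ∀ {z z'} → InTest (θ t) (θ (ι α)) z → θ s z ≡ just z' → θ body z ≡ just z'
    θ-body-just i es = trans (θ-restrict (t · ι α) s (inTest⇒defined t α i)) es

    θ-body-just-inv : ∀ {z z'} → θ body z ≡ just z' → InTest (θ t) (θ (ι α)) z × θ s z ≡ just z'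
    θ-body-just-inv e with θ-restrict-just-inv (t · ι α) s e
    ... | d , es = defined⇒inTest t α d , es

    θ-body-out : ∀ {z} → OutTest (θ t) (θ (ι α)) z → θ body z ≡ nothing
    θ-body-out o = θ-restrict-undefined (t · ι α) s (outTest⇒undefined t α o)

    θ-approx-out : ∀ {z} → OutTest (θ t) (θ (ι α)) z → ∀ k → θ (approx k) z ≡ just z
    θ-approx-out o zero = θ-D-defined (t · ι (α ′)) (outTest⇒defined t α o)
    θ-approx-out {z} o (suc k) =
      trans (θ-ite-out t α (s · approx k) 𝟙 o) (θ-1 z)

    θ-approx-sound : ∀ k {z c} → θ (approx k) z ≡ just c → Σ ℕ λ n → n ℕ.≤ k × ExitsAfter n z c
    θ-approx-sound zero e with θ-D-just-inv (t · ι (α ′)) e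
    ... | refl , d = 0 , z≤n , exitsAfter-zero (defined⇒outTest t α d)
    θ-approx-sound (suc k) {z} e with θ-ite-just-inv t α (s · approx k) 𝟙 e
    ... | inj₁ (i , e') with θ-·-just-inv s (approx k) e'
    ...   | _ , es , ea with θ-approx-sound k ea
    ...     | n , n≤k , ex = suc n , s≤s n≤k , exitsAfter-suc i es ex
    θ-approx-sound (suc k) {z} e | inj₂ (o , e1) with just-injective (trans (sym (θ-1 z)) e1)
    ... | refl = 0 , z≤n , exitsAfter-zero o

    θ-approx-complete : ∀ k {n z c} → ExitsAfter n z c → n ℕ.≤ k → θ (approx k) z ≡ just c
    θ-approx-complete k {zero} ex _ with exitsAfter-zero-inv ex
    ... | refl = θ-approx-out (proj₂ (proj₂ ex)) k
    θ-approx-complete (suc k) {suc n} ex (s≤s n≤k) with exitsAfter-suc-inv ex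
    ... | i , _ , es , ex' =
      trans (θ-ite-in t α (s · approx k) 𝟙 i)
        (trans (θ-·-just s (approx k) es) (θ-approx-complete k ex' n≤k))

    exitsAfter⇒orbit : ∀ {n z c} → ExitsAfter n z c →
                       iter (θ body) n z ≡ just c × (∀ j → iter (θ body) (n + suc j) z ≡ nothing)
    exitsAfter⇒orbit {zero} {z} ex with exitsAfter-zero-inv ex
    ... | refl = refl , λ j → iter-shift-nothing j
      where
      iter-shift-nothing : ∀ j → iter (θ body) (suc j) z ≡ nothing
      iter-shift-nothing j =
        trans (iter-sucˡ (θ body) j z) (cong (_>>= iter (θ body) j) (θ-body-out (proj₂ (proj₂ ex))))
    exitsAfter⇒orbit {suc n} {z} ex with exitsAfter-suc-inv ex
    ... | i , z' , es , ex' with exitsAfter⇒orbit ex'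
    ...   | reach , stuck =
      trans (iter-shift (θ body) n eb) reach ,
      λ j → trans (iter-shift (θ body) (n + suc j) eb) (stuck j)
      where
      eb : θ body z ≡ just z'
      eb = θ-body-just i es

    periodic⇒¬exitsAfter : ∀ i p → pow _·_ body i ≡ pow _·_ body (i + suc p) →
                           ∀ {z c} → ¬ ExitsAfter (suc i) z c
    periodic⇒¬exitsAfter i p per {z} {c} ex with exitsAfter⇒orbit ex
    ... | reach , stuck with (begin
      just c                                  ≡⟨ sym reach ⟩
      iter (θ body) (suc i) z                 ≡⟨ sym (θ-pow body i z) ⟩
      θ (pow _·_ body i) z                    ≡⟨ cong (λ r → θ r z) per ⟩
      θ (pow _·_ body (i + suc p)) z          ≡⟨ θ-pow body (i + suc p) z ⟩
      iter (θ body) (suc i + suc p) z         ≡⟨ stuck p ⟩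
      nothing                                 ∎)
      where open ≡-Reasoning
    ... | ()

    body-approx≤approx : ∀ i p → pow _·_ body i ≡ pow _·_ body (i + suc p) →
                         (body · approx i) ≤ approx i
    body-approx≤approx i p per = θ-⊆⇒≤ λ z c e → step e
      where
      step : ∀ {z c} → θ (body · approx i) z ≡ just c → θ (approx i) z ≡ just c
      step {z} {c} e with θ-·-just-inv body (approx i) e
      ... | z' , eb , ea with θ-body-just-inv eb | θ-approx-sound i ea
      ...   | inside , es | n , n≤i , ex =
        θ-approx-complete i ex' (s≤s⁻¹ (≤∧≢⇒< (s≤s n≤i) λ eq →
          periodic⇒¬exitsAfter i p per (subst (λ m → ExitsAfter m z c) eq ex')))
        where
        ex' : ExitsAfter (suc n) z c
        ex' = exitsAfter-suc inside es ex

    while-exits : ∀ {z y} → θ (while t α s) z ≡ just y → OutTest (θ t) (θ (ι α)) y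
    while-exits {z} {y} e = defined⇒outTest t α (proj₂ (θ-D-just-inv (t · ι (α ′)) eD))
      where
      eD : θ (D (t · ι (α ′))) y ≡ just y
      eD = trans (sym (θ-·-just (while t α s) (D (t · ι (α ′))) e))
             (trans (cong (λ r → θ r z) (while-exit t α s)) e)

    θ-while⊆approx : ∀ i p → pow _·_ body i ≡ pow _·_ body (i + suc p) →
                     ∀ {z y} → θ (while t α s) z ≡ just y → θ (approx i) z ≡ just y
    θ-while⊆approx i p per {z} {y} e = ≤⇒θ-⊆ induction unrolled
      where
      induction : (while t α s · approx i) ≤ approx i
      induction = while-induct t α s (approx i) (body-approx≤approx i p per)
      unrolled : θ (while t α s · approx i) z ≡ just y
      unrolled = trans (θ-·-just (while t α s) (approx i) e) (θ-approx-out (while-exits e) i)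

    θ-while-sound : Periodic _·_ → ∀ {z y} → θ (while t α s) z ≡ just y →
                    ConcreteWhile (θ t) (θ (ι α)) (θ s) z y
    θ-while-sound periodic e with periodic body
    ... | i , p , per = map₂ proj₂ (θ-approx-sound i (θ-while⊆approx i p per e))

    θ-while-in : ∀ {z z'} → InTest (θ t) (θ (ι α)) z → θ s z ≡ just z' →
                 θ (while t α s) z ≡ θ (while t α s) z'
    θ-while-in {z} {z'} i es = begin
      θ (while t α s) z                        ≡⟨ cong (λ r → θ r z) (while-unfold t α s) ⟩
      θ (ite t α (s · while t α s) 𝟙) z        ≡⟨ θ-ite-in t α (s · while t α s) 𝟙 i ⟩
      θ (s · while t α s) z                    ≡⟨ θ-·-just s (while t α s) es ⟩
      θ (while t α s) z'                       ∎
      where open ≡-Reasoning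

    θ-while-out : ∀ {z} → OutTest (θ t) (θ (ι α)) z → θ (while t α s) z ≡ just z
    θ-while-out {z} o = begin
      θ (while t α s) z                        ≡⟨ cong (λ r → θ r z) (while-unfold t α s) ⟩
      θ (ite t α (s · while t α s) 𝟙) z        ≡⟨ θ-ite-out t α (s · while t α s) 𝟙 o ⟩
      θ 𝟙 z                                    ≡⟨ θ-1 z ⟩
      just z                                   ∎
      where open ≡-Reasoning

    θ-while-complete : ∀ {n z y} → ExitsAfter n z y → θ (while t α s) z ≡ just y
    θ-while-complete {zero} ex with exitsAfter-zero-inv ex
    ... | refl = θ-while-out (proj₂ (proj₂ ex))
    θ-while-complete {suc n} ex with exitsAfter-suc-inv ex
    ... | i , _ , es , ex' = trans (θ-while-in i es) (θ-while-complete ex')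

    θ-while : Periodic _·_ → ∀ z y →
              (θ (while t α s) z ≡ just y) ⇔ ConcreteWhile (θ t) (θ (ι α)) (θ s) z y
    θ-while periodic z y = mk⇔ (θ-while-sound periodic) λ (_ , ex) → θ-while-complete ex

theorem4p3 : ∀ {a b x : Level} {S : Set a} {B : Set b}
    (R : RestrictionMonoidWithTests S B)
    (I : ExtendedIfThenElse R)
    (W : KleeneanWhile R I) →
    Periodic (RestrictionMonoidWithTests._·_ R) →
    {X : Set x} (ρ : Representation R X) →
    let open RestrictionMonoidWithTests R
        open ExtendedIfThenElse I
        open KleeneanWhile W
        open Representation ρ
    in (∀ s α t u z →
          θ (ite s α t u) z ≡ concreteIte (θ s) (θ (ι α)) (θ t) (θ u) z)
       × (∀ t α s z y →
          (θ (while t α s) z ≡ just y) ⇔ ConcreteWhile (θ t) (θ (ι α)) (θ s) z y)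
theorem4p3 R I W periodic ρ =
  IfThenElse.θ-ite R I ρ , λ t α s → WhileDo.θ-while R I W ρ t α s periodic
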